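{- Consider the spaces $F(n,m(n),B,P)$ and $F(n,m'(n),B,P)$, where $m'(n)=\omega(m(n))$. If a random instance in $F(n,m(n),B,P)$ is UNSAT with probability bounded away from $0$ (as $n\to\infty$), then a random instance in $F(n,m'(n),B,P)$ is UNSAT w.h.p.
   Context: Community model. There are $n$ Boolean variables, partitioned into $B$ communities of equal size $h$, $n=Bh$, $\mathcal{C}_i=\{v_j:(i-1)h+1\le j\le ih\}$. A clause is a disjunction of literals (variables or negations) on distinct variables; an instance is a conjunction of clauses, UNSAT if no truth assignment satisfies it. A clause type $\mathbf{K}=(k_1,\ldots,k_\ell)$ is a non-increasing tuple of positive integers ($\ell\le B$, $k_j\le h$); $\Omega_B(n,\mathbf{K})$ is the set of clauses with exactly $k_j$ variables from the $j$-th of some $\ell$ mutually distinct communities; $P_{\mathbf{K}}$ is uniform on it. For fixed distinct types $\mathbf{K}_1,\ldots,\mathbf{K}_T$ and fixed probabilities $p_t$ summing to $1$, $P=\sum_tp_tP_{\mathbf{K}_t}$, and $F(n,m,B,P)$ is the space of instances formed by $m$ independent clauses each distributed according to $P$. Asymptotics as $n\to\infty$ with $B=B(n)$; w.h.p. means with probability tending to $1$; $m'=\omega(m)$ means $m/m'\to0$.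
   Formalization: The mixture weights $p_t$ are rational rather than real. -}

module Defs where

open import Data.Nat as ℕ using (ℕ; zero; suc)
open import Data.Integer using (+_)
open import Data.Fin using (Fin; zero; suc)
open import Data.Bool using (Bool; true; false; if_then_else_; _∧_; _∨_; not)
open import Data.Maybe using (Maybe; just; nothing; is-just)
open import Data.List using (List; []; _∷_; [_]; map; concatMap; length; foldr; allFin)
open import Data.Bool.ListAction using (and; or)
open import Data.List.Properties using (≡-dec)
open import Data.List.Relation.Unary.All using (All)
open import Data.List.Relation.Unary.Linked using (Linked)
open import Data.Product using (∃; _×_)
open import Relation.Nullary.Decidable using (⌊_⌋)
open import Relation.Binary.PropositionalEquality using (_≡_)
open import Data.Rational using (ℚ; 0ℚ; 1ℚ; _+_; _*_; _-_; _≤_; _<_; _/_)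

allFuns : {A : Set} (k : ℕ) → List A → List (Fin k → A)
allFuns zero    xs = [ (λ ()) ]
allFuns (suc k) xs =
  concatMap (λ a → map (λ f → λ { zero → a ; (suc i) → f i }) (allFuns k xs)) xs

filterᵇ : {A : Set} → (A → Bool) → List A → List A
filterᵇ p []       = []
filterᵇ p (x ∷ xs) = if p x then x ∷ filterᵇ p xs else filterᵇ p xs

sumℚ : List ℚ → ℚ
sumℚ = foldr _+_ 0ℚ

prodℚ : List ℚ → ℚ
prodℚ = foldr _*_ 1ℚ

fromℕ : ℕ → ℚ
fromℕ k = + k / 1

-- 1/k for k > 0, and 0 for k = 0 (uniform weight on a set of size k)
unif : ℕ → ℚ
unif zero    = 0ℚ
unif (suc k) = + 1 / suc k

insertDesc : ℕ → List ℕ → List ℕ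
insertDesc x []       = [ x ]
insertDesc x (y ∷ ys) = if y ℕ.≤ᵇ x then x ∷ y ∷ ys else y ∷ insertDesc x ys

sortDesc : List ℕ → List ℕ
sortDesc = foldr insertDesc []

-- Community model with B communities of size h.
-- Variable (i , a) : Fin B × Fin h is the a-th variable of community i
-- (so there are n = B h variables, community C_i = {i} × Fin h).

-- A clause on distinct variables: for each variable, either it does not
-- occur (nothing), occurs positively (just true) or negated (just false).
Clause : ℕ → ℕ → Set
Clause B h = Fin B → Fin h → Maybe Bool

Assignment : ℕ → ℕ → Set
Assignment B h = Fin B → Fin h → Bool

maybeBools : List (Maybe Bool)
maybeBools = nothing ∷ just true ∷ just false ∷ []

allClauses : (B h : ℕ) → List (Clause B h)
allClauses B h = allFuns B (allFuns h maybeBools)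

allAssignments : (B h : ℕ) → List (Assignment B h)
allAssignments B h = allFuns B (allFuns h (true ∷ false ∷ []))

litSat : Maybe Bool → Bool → Bool
litSat nothing      v = false
litSat (just true)  v = v
litSat (just false) v = not v

clauseSat : {B h : ℕ} → Assignment B h → Clause B h → Bool
clauseSat {B} {h} σ c =
  or (map (λ i → or (map (λ a → litSat (c i a) (σ i a)) (allFin h))) (allFin B))

Instance : ℕ → ℕ → ℕ → Set
Instance B h m = Fin m → Clause B h

instanceSat : {B h m : ℕ} → Assignment B h → Instance B h m → Bool
instanceSat {m = m} σ F = and (map (λ j → clauseSat σ (F j)) (allFin m))

isUnsat : {B h m : ℕ} → Instance B h m → Bool
isUnsat {B} {h} F = not (or (map (λ σ → instanceSat σ F) (allAssignments B h)))

commCount : {B h : ℕ} → Clause B h → Fin B → ℕ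
commCount {h = h} c i = length (filterᵇ is-just (map (c i) (allFin h)))

clauseType : {B h : ℕ} → Clause B h → List ℕ
clauseType {B} c =
  sortDesc (filterᵇ (λ k → not (k ℕ.≡ᵇ 0)) (map (commCount c) (allFin B)))

hasType : {B h : ℕ} → List ℕ → Clause B h → Bool
hasType K c = ⌊ ≡-dec ℕ._≟_ (clauseType c) K ⌋

Ω : (B h : ℕ) → List ℕ → List (Clause B h)
Ω B h K = filterᵇ (hasType K) (allClauses B h)

PK : (B h : ℕ) → List ℕ → Clause B h → ℚ
PK B h K c = if hasType K c then unif (length (Ω B h K)) else 0ℚ

Pmix : (B h T : ℕ) → (Fin T → List ℕ) → (Fin T → ℚ) → Clause B h → ℚ
Pmix B h T K p c = sumℚ (map (λ t → p t * PK B h (K t) c) (allFin T))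

-- probability that a random instance of F(n, m, B, P) is UNSAT
-- (m independent clauses, each distributed according to P)
PrUnsat : (B h T : ℕ) → (Fin T → List ℕ) → (Fin T → ℚ) → ℕ → ℚ
PrUnsat B h T K p m =
  sumℚ (map (λ F → prodℚ (map (λ j → Pmix B h T K p (F j)) (allFin m))
                   * (if isUnsat F then 1ℚ else 0ℚ))
            (allFuns m (allClauses B h)))

Eventually : (ℕ → Set) → Set
Eventually Q = ∃ λ N → ∀ n → N ℕ.≤ n → Q n

IsClauseType : List ℕ → Set
IsClauseType K = (1 ℕ.≤ length K) × All (λ k → 1 ℕ.≤ k) K × Linked ℕ._≥_ K

FitsType : ℕ → ℕ → List ℕ → Set
FitsType B h K = (length K ℕ.≤ B) × All (λ k → k ℕ.≤ h) K

IsOmegaOf : (m' m : ℕ → ℕ) → Set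
IsOmegaOf m' m = ∀ (ε : ℚ) → 0ℚ < ε → Eventually (λ n → fromℕ (m n) ≤ ε * fromℕ (m' n))

BoundedAwayFromZero : (ℕ → ℚ) → Set
BoundedAwayFromZero f = ∃ λ ε → (0ℚ < ε) × Eventually (λ n → ε ≤ f n)

TendsToOne : (ℕ → ℚ) → Set
TendsToOne f = ∀ (ε : ℚ) → 0ℚ < ε → Eventually (λ n → 1ℚ - ε ≤ f n)

module Submission where

-- Let σ(m) be the probability that m independent clauses drawn from P are
-- simultaneously satisfiable.  An assignment satisfying a concatenation of two
-- instances satisfies each of them, so σ(a + b) ≤ σ(a) σ(b); with σ ≤ 1 this
-- gives σ(m') ≤ σ(m)^k whenever k m ≤ m'.  Eventually σ(m(n)) ≤ 1 - e with
-- e > 0, and for each fixed k eventually k m(n) ≤ m'(n); Bernoulli's inequality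
-- and the Archimedean property make (1 - e)^k ≤ ε for k large.

open import Defs
open import Data.Nat using (ℕ; _*_)
open import Data.Fin using (Fin)
open import Data.List using (List; map; allFin)
open import Data.Rational using (ℚ; 0ℚ; 1ℚ; _≤_)
open import Relation.Binary.PropositionalEquality using (_≡_)

import Data.Nat as N
import Data.Nat.Properties as NP
import Data.Integer as Z
import Data.Integer.Properties as ZP
import Data.Nat.Coprimality as Coprime
open import Data.Fin using (zero; suc)
open import Data.Bool using (Bool; true; false; not; T; if_then_else_)
open import Data.Bool.ListAction using (and; or)
open import Data.List using ([]; _∷_; _++_; concatMap; length; tabulate)
import Data.List.Properties as LP
open import Data.List.Relation.Unary.Any using (Any; here; there)
import Data.List.Relation.Unary.Any as Any
import Data.List.Relation.Unary.Any.Properties as AnyP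
import Data.List.Relation.Unary.All.Properties as AllP
open import Data.List.Relation.Binary.Subset.Propositional using (_⊆_)
import Data.List.Relation.Binary.Subset.Propositional.Properties as SubsetP
open import Data.Product using (_×_; _,_; proj₁; proj₂; ∃)
open import Data.Empty using (⊥-elim)
open import Data.Maybe using (Maybe; just; nothing; is-just)
open import Data.List.Relation.Unary.All using (All; _∷_)
open import Data.List.Relation.Unary.Linked using (Linked; _∷_)
open import Relation.Nullary.Decidable using (fromWitness)
open import Relation.Binary.PropositionalEquality
  using (refl; sym; trans; cong; cong₂; subst; subst₂; module ≡-Reasoning)
open import Data.Rational using (mkℚ; _+_; _-_; _<_; _/_; nonNegative) renaming (_*_ to _·_)
import Data.Rational as Q
import Data.Rational.Properties as QP
open import Data.Rational.Solver using (module +-*-Solver)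
open import Algebra.Definitions.RawSemiring Q.+-*-rawSemiring using (_^_)
open import Function using (_∘_)

sum-cong : {A : Set} {f g : A → ℚ} (xs : List A) → (∀ x → f x ≡ g x) →
           sumℚ (map f xs) ≡ sumℚ (map g xs)
sum-cong xs f≗g = cong sumℚ (LP.map-cong f≗g xs)

sum-++ : (xs ys : List ℚ) → sumℚ (xs ++ ys) ≡ sumℚ xs + sumℚ ys
sum-++ []       ys = sym (QP.+-identityˡ _)
sum-++ (x ∷ xs) ys = trans (cong (x +_) (sum-++ xs ys)) (sym (QP.+-assoc x _ _))

sum-concatMap : {A B : Set} (H : B → ℚ) (f : A → List B) (xs : List A) →
  sumℚ (map H (concatMap f xs)) ≡ sumℚ (map (λ x → sumℚ (map H (f x))) xs)
sum-concatMap H f []       = refl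
sum-concatMap H f (x ∷ xs) = begin
  sumℚ (map H (f x ++ concatMap f xs))
    ≡⟨ cong sumℚ (LP.map-++ H (f x) (concatMap f xs)) ⟩
  sumℚ (map H (f x) ++ map H (concatMap f xs))
    ≡⟨ sum-++ (map H (f x)) _ ⟩
  sumℚ (map H (f x)) + sumℚ (map H (concatMap f xs))
    ≡⟨ cong (sumℚ (map H (f x)) +_) (sum-concatMap H f xs) ⟩
  sumℚ (map (λ x → sumℚ (map H (f x))) (x ∷ xs)) ∎
  where open ≡-Reasoning

sum-scaleˡ : {A : Set} (c : ℚ) (f : A → ℚ) (xs : List A) →
  sumℚ (map (λ x → c · f x) xs) ≡ c · sumℚ (map f xs)
sum-scaleˡ c f []       = sym (QP.*-zeroʳ c)
sum-scaleˡ c f (x ∷ xs) =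
  trans (cong (c · f x +_) (sum-scaleˡ c f xs)) (sym (QP.*-distribˡ-+ c (f x) _))

sum-scaleʳ : {A : Set} (c : ℚ) (f : A → ℚ) (xs : List A) →
  sumℚ (map (λ x → f x · c) xs) ≡ sumℚ (map f xs) · c
sum-scaleʳ c f xs = begin
  sumℚ (map (λ x → f x · c) xs) ≡⟨ sum-cong xs (λ x → QP.*-comm (f x) c) ⟩
  sumℚ (map (λ x → c · f x) xs) ≡⟨ sum-scaleˡ c f xs ⟩
  c · sumℚ (map f xs)           ≡⟨ QP.*-comm c _ ⟩
  sumℚ (map f xs) · c           ∎
  where open ≡-Reasoning

sum-+ : {A : Set} (f g : A → ℚ) (xs : List A) →
  sumℚ (map (λ x → f x + g x) xs) ≡ sumℚ (map f xs) + sumℚ (map g xs)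
sum-+ f g []       = refl
sum-+ f g (x ∷ xs) =
  trans (cong ((f x + g x) +_) (sum-+ f g xs)) (interchange (f x) (g x) _ _)
  where
  open +-*-Solver
  interchange : ∀ a b c d → (a + b) + (c + d) ≡ (a + c) + (b + d)
  interchange = solve 4 (λ a b c d → (a :+ b) :+ (c :+ d) := (a :+ c) :+ (b :+ d)) refl

sum-zero : {A : Set} (xs : List A) → sumℚ (map (λ _ → 0ℚ) xs) ≡ 0ℚ
sum-zero []       = refl
sum-zero (x ∷ xs) = trans (QP.+-identityˡ _) (sum-zero xs)

sum-swap : {A B : Set} (f : A → B → ℚ) (xs : List A) (ys : List B) →
  sumℚ (map (λ x → sumℚ (map (f x) ys)) xs) ≡ sumℚ (map (λ y → sumℚ (map (λ x → f x y) xs)) ys)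
sum-swap f []       ys = sym (sum-zero ys)
sum-swap f (x ∷ xs) ys =
  trans (cong (sumℚ (map (f x) ys) +_) (sum-swap f xs ys))
        (sym (sum-+ (f x) (λ y → sumℚ (map (λ x → f x y) xs)) ys))

sum-mono : {A : Set} {f g : A → ℚ} (xs : List A) → (∀ x → f x ≤ g x) →
  sumℚ (map f xs) ≤ sumℚ (map g xs)
sum-mono []       f≤g = QP.≤-refl
sum-mono (x ∷ xs) f≤g = QP.+-mono-≤ (f≤g x) (sum-mono xs f≤g)

sum-nonneg : {A : Set} {f : A → ℚ} (xs : List A) → (∀ x → 0ℚ ≤ f x) → 0ℚ ≤ sumℚ (map f xs)
sum-nonneg xs f≥0 = QP.≤-trans (QP.≤-reflexive (sym (sum-zero xs))) (sum-mono xs f≥0)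

0≤1 : 0ℚ ≤ 1ℚ
0≤1 = QP.nonNegative⁻¹ 1ℚ

·-nonneg : ∀ {a b} → 0ℚ ≤ a → 0ℚ ≤ b → 0ℚ ≤ a · b
·-nonneg {a} {b} a≥0 b≥0 =
  QP.nonNegative⁻¹ (a · b) {{QP.nonNeg*nonNeg⇒nonNeg a {{nonNegative a≥0}} b {{nonNegative b≥0}}}}

·-monoʳ : ∀ {a b} c → 0ℚ ≤ c → a ≤ b → a · c ≤ b · c
·-monoʳ c c≥0 = QP.*-monoʳ-≤-nonNeg c {{nonNegative c≥0}}

·-monoˡ : ∀ {a b} c → 0ℚ ≤ c → a ≤ b → c · a ≤ c · b
·-monoˡ c c≥0 = QP.*-monoˡ-≤-nonNeg c {{nonNegative c≥0}}

·-mono : ∀ {a b c d} → 0ℚ ≤ b → 0ℚ ≤ c → a ≤ b → c ≤ d → a · c ≤ b · d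
·-mono {c = c} {d} b≥0 c≥0 a≤b c≤d = QP.≤-trans (·-monoʳ c c≥0 a≤b) (·-monoˡ _ b≥0 c≤d)

≤-1-swap : ∀ e x → e ≤ 1ℚ - x → x ≤ 1ℚ - e
≤-1-swap e x e≤1-x = subst₂ _≤_ (shift-left e x) (shift-right e x) (QP.+-monoˡ-≤ (x - e) e≤1-x)
  where
  open +-*-Solver
  shift-left : ∀ e x → e + (x - e) ≡ x
  shift-left = solve 2 (λ e x → e :+ (x :- e) := x) refl
  shift-right : ∀ e x → (1ℚ - x) + (x - e) ≡ 1ℚ - e
  shift-right = solve 2 (λ e x → (con 1ℚ :- x) :+ (x :- e) := con 1ℚ :- e) refl

^-nonneg : ∀ {x} k → 0ℚ ≤ x → 0ℚ ≤ x ^ k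
^-nonneg N.zero    x≥0 = 0≤1
^-nonneg (N.suc k) x≥0 = ·-nonneg x≥0 (^-nonneg k x≥0)

^-mono : ∀ {x y} k → 0ℚ ≤ x → x ≤ y → x ^ k ≤ y ^ k
^-mono N.zero    x≥0 x≤y = QP.≤-refl
^-mono (N.suc k) x≥0 x≤y =
  ·-mono (QP.≤-trans x≥0 x≤y) (^-nonneg k x≥0) x≤y (^-mono k x≥0 x≤y)

fromℕ-mkℚ : ∀ n → fromℕ n ≡ mkℚ (Z.+ n) 0 (Coprime.sym (Coprime.1-coprimeTo n))
fromℕ-mkℚ n = QP.normalize-coprime (Coprime.sym (Coprime.1-coprimeTo n))

unif-mkℚ : ∀ k → unif (N.suc k) ≡ mkℚ (Z.+ 1) k (Coprime.1-coprimeTo (N.suc k))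
unif-mkℚ k = QP.normalize-coprime (Coprime.1-coprimeTo (N.suc k))

fromℕ-nonneg : ∀ n → 0ℚ ≤ fromℕ n
fromℕ-nonneg n = QP.nonNegative⁻¹ _ {{QP.normalize-nonNeg n 1}}

fromℕ-suc : ∀ n → fromℕ (N.suc n) ≡ 1ℚ + fromℕ n
fromℕ-suc n rewrite fromℕ-mkℚ n = cong (λ z → (Z.+ 1 Z.+ z) / 1) (sym (ZP.*-identityʳ (Z.+ n)))

fromℕ-* : ∀ a b → fromℕ a · fromℕ b ≡ fromℕ (a * b)
fromℕ-* a b rewrite fromℕ-mkℚ a | fromℕ-mkℚ b = cong (_/ 1) (sym (ZP.pos-* a b))

fromℕ-cancel-≤ : ∀ {a b} → fromℕ a ≤ fromℕ b → a N.≤ b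
fromℕ-cancel-≤ {a} {b} a≤b =
  ZP.drop‿+≤+ (subst₂ Z._≤_ (ZP.*-identityʳ (Z.+ a)) (ZP.*-identityʳ (Z.+ b))
    (QP.drop-*≤* (subst₂ _≤_ (fromℕ-mkℚ a) (fromℕ-mkℚ b) a≤b)))

fromℕ-unif : ∀ k → fromℕ (N.suc k) · unif (N.suc k) ≡ 1ℚ
fromℕ-unif k rewrite fromℕ-mkℚ (N.suc k) | unif-mkℚ k =
  QP.*-inverseʳ (mkℚ (Z.+ N.suc k) 0 (Coprime.sym (Coprime.1-coprimeTo (N.suc k))))

unif-pos : ∀ k → 0ℚ < unif (N.suc k)
unif-pos k = QP.positive⁻¹ _ {{QP.normalize-pos 1 (N.suc k)}}

unif-nonneg : ∀ k → 0ℚ ≤ unif k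
unif-nonneg N.zero    = QP.≤-refl
unif-nonneg (N.suc k) = QP.<⇒≤ (unif-pos k)

sum-indicator : {A : Set} (P : A → Bool) (u : ℚ) (xs : List A) →
  sumℚ (map (λ x → if P x then u else 0ℚ) xs) ≡ fromℕ (length (filterᵇ P xs)) · u
sum-indicator P u []       = sym (QP.*-zeroˡ u)
sum-indicator P u (x ∷ xs) with P x
... | false = trans (QP.+-identityˡ _) (sum-indicator P u xs)
... | true  = begin
  u + sumℚ (map (λ x → if P x then u else 0ℚ) xs) ≡⟨ cong (u +_) (sum-indicator P u xs) ⟩
  u + fromℕ L · u                                 ≡⟨ cong (_+ fromℕ L · u) (sym (QP.*-identityˡ u)) ⟩
  1ℚ · u + fromℕ L · u                            ≡⟨ sym (QP.*-distribʳ-+ u 1ℚ (fromℕ L)) ⟩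
  (1ℚ + fromℕ L) · u                              ≡⟨ cong (_· u) (sym (fromℕ-suc L)) ⟩
  fromℕ (N.suc L) · u                             ∎
  where
  open ≡-Reasoning
  L = length (filterᵇ P xs)

bernoulli : ∀ e k → 0ℚ ≤ e → 0ℚ ≤ 1ℚ - e → (1ℚ - e) ^ k · (1ℚ + fromℕ k · e) ≤ 1ℚ
bernoulli e N.zero    e≥0 1-e≥0 = QP.≤-reflexive (solve 1 (λ e → con 1ℚ :* (con 1ℚ :+ con 0ℚ :* e) := con 1ℚ) refl e)
  where open +-*-Solver
bernoulli e (N.suc k) e≥0 1-e≥0 = begin
  (1ℚ - e) ^ N.suc k · (1ℚ + fromℕ (N.suc k) · e)
    ≡⟨ cong (λ z → (1ℚ - e) ^ N.suc k · (1ℚ + z · e)) (fromℕ-suc k) ⟩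
  ((1ℚ - e) · P) · (1ℚ + (1ℚ + n) · e)
    ≡⟨ expand P e n ⟩
  P · ((1ℚ + n · e) - (n · e · e + e · e))
    ≤⟨ ·-monoˡ P (^-nonneg k 1-e≥0) drop-square-terms ⟩
  P · (1ℚ + n · e)
    ≤⟨ bernoulli e k e≥0 1-e≥0 ⟩
  1ℚ ∎
  where
  open QP.≤-Reasoning
  open +-*-Solver
  P = (1ℚ - e) ^ k
  n = fromℕ k
  expand : ∀ P e n → ((1ℚ - e) · P) · (1ℚ + (1ℚ + n) · e) ≡ P · ((1ℚ + n · e) - (n · e · e + e · e))
  expand = solve 3 (λ P e n → ((con 1ℚ :- e) :* P) :* (con 1ℚ :+ (con 1ℚ :+ n) :* e)
                              := P :* ((con 1ℚ :+ n :* e) :- (n :* e :* e :+ e :* e))) refl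
  squares≥0 : 0ℚ ≤ n · e · e + e · e
  squares≥0 = QP.+-mono-≤ (·-nonneg (·-nonneg (fromℕ-nonneg k) e≥0) e≥0) (·-nonneg e≥0 e≥0)
  drop-square-terms : (1ℚ + n · e) - (n · e · e + e · e) ≤ 1ℚ + n · e
  drop-square-terms = subst ((1ℚ + n · e) - (n · e · e + e · e) ≤_) (QP.+-identityʳ _)
                        (QP.+-monoʳ-≤ (1ℚ + n · e) (QP.neg-antimono-≤ squares≥0))

archimedean : ∀ {q} → 0ℚ < q → ∃ λ a → 1ℚ ≤ fromℕ a · q
archimedean {mkℚ (Z.+ 0) _ _} q>0 with Q.positive q>0
... | ()
archimedean {mkℚ Z.-[1+ _ ] _ _} q>0 with Q.positive q>0
... | ()
archimedean {q@(mkℚ (Z.+ N.suc a) d _)} q>0 = N.suc d , (begin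
  1ℚ                             ≡⟨ sym (fromℕ-unif d) ⟩
  fromℕ (N.suc d) · unif (N.suc d) ≤⟨ ·-monoˡ (fromℕ (N.suc d)) (fromℕ-nonneg (N.suc d)) 1/[d+1]≤q ⟩
  fromℕ (N.suc d) · q            ∎)
  where
  open QP.≤-Reasoning
  1/[d+1]≤q : unif (N.suc d) ≤ q
  1/[d+1]≤q rewrite unif-mkℚ d =
    Q.*≤* (subst₂ Z._≤_ (sym (ZP.*-identityˡ (Z.+ N.suc d))) (sym (ZP.pos-* (N.suc a) (N.suc d)))
            (Z.+≤+ (NP.m≤n*m (N.suc d) (N.suc a))))

geometric-decay : ∀ {e ε} → 0ℚ < e → 0ℚ < ε →
  ∃ λ k → ∀ x → 0ℚ ≤ x → x ≤ 1ℚ - e → x ^ k ≤ ε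
geometric-decay {e} {ε} e>0 ε>0 with archimedean e>0 | archimedean ε>0
... | a , 1≤ae | b , 1≤bε = a * b , λ x x≥0 x≤1-e →
  QP.≤-trans (^-mono (a * b) x≥0 x≤1-e) (small (QP.≤-trans x≥0 x≤1-e))
  where
  k = a * b
  e≥0 = QP.<⇒≤ e>0
  ε≥0 = QP.<⇒≤ ε>0
  1≤keε : 1ℚ ≤ fromℕ k · e · ε
  1≤keε = begin
    1ℚ                           ≤⟨ ·-mono (QP.≤-trans 0≤1 1≤ae) 0≤1 1≤ae 1≤bε ⟩
    (fromℕ a · e) · (fromℕ b · ε) ≡⟨ regroup (fromℕ a) (fromℕ b) e ε ⟩
    (fromℕ a · fromℕ b) · e · ε   ≡⟨ cong (λ z → z · e · ε) (fromℕ-* a b) ⟩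
    fromℕ k · e · ε              ∎
    where
    open QP.≤-Reasoning
    open +-*-Solver
    regroup : ∀ a b e ε → (a · e) · (b · ε) ≡ (a · b) · e · ε
    regroup = solve 4 (λ a b e ε → (a :* e) :* (b :* ε) := (a :* b) :* e :* ε) refl
  ke≤1+ke : fromℕ k · e ≤ 1ℚ + fromℕ k · e
  ke≤1+ke = subst (_≤ 1ℚ + fromℕ k · e) (QP.+-identityˡ _) (QP.+-monoˡ-≤ (fromℕ k · e) 0≤1)
  small : 0ℚ ≤ 1ℚ - e → (1ℚ - e) ^ k ≤ ε
  small 1-e≥0 = begin
    P                          ≡⟨ sym (QP.*-identityʳ P) ⟩
    P · 1ℚ                     ≤⟨ ·-monoˡ P P≥0 1≤keε ⟩
    P · (fromℕ k · e · ε)        ≤⟨ ·-monoˡ P P≥0 (·-monoʳ ε ε≥0 ke≤1+ke) ⟩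
    P · ((1ℚ + fromℕ k · e) · ε) ≡⟨ sym (QP.*-assoc P _ ε) ⟩
    (P · (1ℚ + fromℕ k · e)) · ε ≤⟨ ·-monoʳ ε ε≥0 (bernoulli e k e≥0 1-e≥0) ⟩
    1ℚ · ε                     ≡⟨ QP.*-identityˡ ε ⟩
    ε                          ∎
    where
    open QP.≤-Reasoning
    P = (1ℚ - e) ^ k
    P≥0 = ^-nonneg k 1-e≥0

ind : Bool → ℚ
ind b = if b then 1ℚ else 0ℚ

ind-nonneg : ∀ b → 0ℚ ≤ ind b
ind-nonneg true  = 0≤1
ind-nonneg false = QP.≤-refl

ind-≤1 : ∀ b → ind b ≤ 1ℚ
ind-≤1 true  = QP.≤-refl
ind-≤1 false = 0≤1

ind-not-+ : ∀ b → ind (not b) + ind b ≡ 1ℚ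
ind-not-+ true  = refl
ind-not-+ false = refl

ind-≤-· : ∀ a b c → (T a → T b × T c) → ind a ≤ ind b · ind c
ind-≤-· false b     c     _   = ·-nonneg (ind-nonneg b) (ind-nonneg c)
ind-≤-· true  true  true  _   = QP.≤-refl
ind-≤-· true  false c     a⇒bc = ⊥-elim (proj₁ (a⇒bc _))
ind-≤-· true  true  false a⇒bc = ⊥-elim (proj₂ (a⇒bc _))

tuples : {C : Set} → ℕ → List C → List (List C)
tuples N.zero    cs = [] ∷ []
tuples (N.suc m) cs = concatMap (λ c → map (c ∷_) (tuples m cs)) cs

module ProductMeasure {C : Set} (cs : List C) (w : C → ℚ) (w-nonneg : ∀ c → 0ℚ ≤ w c) where

  weight : List C → ℚ
  weight ℓ = prodℚ (map w ℓ)

  weight-nonneg : ∀ ℓ → 0ℚ ≤ weight ℓ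
  weight-nonneg []      = 0≤1
  weight-nonneg (c ∷ ℓ) = ·-nonneg (w-nonneg c) (weight-nonneg ℓ)

  weight-++ : ∀ u v → weight (u ++ v) ≡ weight u · weight v
  weight-++ []      v = sym (QP.*-identityˡ _)
  weight-++ (c ∷ u) v = trans (cong (w c ·_) (weight-++ u v)) (sym (QP.*-assoc (w c) _ _))

  sum-tuples-suc : ∀ m (H : List C → ℚ) →
    sumℚ (map H (tuples (N.suc m) cs)) ≡ sumℚ (map (λ c → sumℚ (map (H ∘ (c ∷_)) (tuples m cs))) cs)
  sum-tuples-suc m H = trans (sum-concatMap H _ cs)
    (sum-cong cs (λ c → cong sumℚ (sym (LP.map-∘ (tuples m cs)))))

  sum-tuples-+ : ∀ a b (H : List C → ℚ) →
    sumℚ (map H (tuples (a N.+ b) cs)) ≡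
    sumℚ (map (λ u → sumℚ (map (λ v → H (u ++ v)) (tuples b cs))) (tuples a cs))
  sum-tuples-+ N.zero    b H = sym (QP.+-identityʳ _)
  sum-tuples-+ (N.suc a) b H = begin
    sumℚ (map H (tuples (N.suc a N.+ b) cs))
      ≡⟨ sum-tuples-suc (a N.+ b) H ⟩
    sumℚ (map (λ c → sumℚ (map (H ∘ (c ∷_)) (tuples (a N.+ b) cs))) cs)
      ≡⟨ sum-cong cs (λ c → sum-tuples-+ a b (H ∘ (c ∷_))) ⟩
    sumℚ (map (λ c → sumℚ (map (G ∘ (c ∷_)) (tuples a cs))) cs)
      ≡⟨ sym (sum-tuples-suc a G) ⟩
    sumℚ (map G (tuples (N.suc a) cs)) ∎
    where
    open ≡-Reasoning
    G : List C → ℚ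
    G u = sumℚ (map (λ v → H (u ++ v)) (tuples b cs))

  total-weight : sumℚ (map w cs) ≡ 1ℚ → ∀ m → sumℚ (map weight (tuples m cs)) ≡ 1ℚ
  total-weight w-total N.zero    = QP.+-identityʳ 1ℚ
  total-weight w-total (N.suc m) = begin
    sumℚ (map weight (tuples (N.suc m) cs))
      ≡⟨ sum-tuples-suc m weight ⟩
    sumℚ (map (λ c → sumℚ (map (λ ℓ → w c · weight ℓ) (tuples m cs))) cs)
      ≡⟨ sum-cong cs (λ c → trans (sum-scaleˡ (w c) weight (tuples m cs))
                                  (trans (cong (w c ·_) (total-weight w-total m)) (QP.*-identityʳ (w c)))) ⟩
    sumℚ (map w cs)
      ≡⟨ w-total ⟩
    1ℚ ∎
    where open ≡-Reasoning

  module Satisfiability {Asg : Set} (assignments : List Asg) (sat : Asg → C → Bool) where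

    satisfiable : List C → Bool
    satisfiable ℓ = or (map (λ σ → and (map (sat σ) ℓ)) assignments)

    satisfiable-antitone : ∀ {u ℓ} → u ⊆ ℓ → T (satisfiable ℓ) → T (satisfiable u)
    satisfiable-antitone u⊆ℓ =
      AnyP.any⁺ _ ∘ Any.map (λ {σ} → AllP.all-anti-mono (sat σ) u⊆ℓ) ∘ AnyP.any⁻ _ assignments

    satProb : ℕ → ℚ
    satProb m = sumℚ (map (λ ℓ → weight ℓ · ind (satisfiable ℓ)) (tuples m cs))

    unsatProb : ℕ → ℚ
    unsatProb m = sumℚ (map (λ ℓ → weight ℓ · ind (not (satisfiable ℓ))) (tuples m cs))

    satProb-nonneg : ∀ m → 0ℚ ≤ satProb m
    satProb-nonneg m = sum-nonneg (tuples m cs) (λ ℓ → ·-nonneg (weight-nonneg ℓ) (ind-nonneg _))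

    -- σ(a + b) ≤ σ(a) σ(b): both halves of a satisfiable tuple are satisfiable.
    satProb-submult : ∀ a b → satProb (a N.+ b) ≤ satProb a · satProb b
    satProb-submult a b = begin
      satProb (a N.+ b)
        ≡⟨ sum-tuples-+ a b mass ⟩
      sumℚ (map (λ u → sumℚ (map (λ v → mass (u ++ v)) (tuples b cs))) (tuples a cs))
        ≤⟨ sum-mono (tuples a cs) (λ u → sum-mono (tuples b cs) (mass-++ u)) ⟩
      sumℚ (map (λ u → sumℚ (map (λ v → mass u · mass v) (tuples b cs))) (tuples a cs))
        ≡⟨ sum-cong (tuples a cs) (λ u → sum-scaleˡ (mass u) mass (tuples b cs)) ⟩
      sumℚ (map (λ u → mass u · satProb b) (tuples a cs))
        ≡⟨ sum-scaleʳ (satProb b) mass (tuples a cs) ⟩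
      satProb a · satProb b ∎
      where
      open QP.≤-Reasoning
      mass : List C → ℚ
      mass ℓ = weight ℓ · ind (satisfiable ℓ)
      open +-*-Solver
      interchange : ∀ p q r s → (p · q) · (r · s) ≡ (p · r) · (q · s)
      interchange = solve 4 (λ p q r s → (p :* q) :* (r :* s) := (p :* r) :* (q :* s)) refl
      halves : ∀ u v → T (satisfiable (u ++ v)) → T (satisfiable u) × T (satisfiable v)
      halves u v s = satisfiable-antitone (SubsetP.xs⊆xs++ys u v) s
                   , satisfiable-antitone (SubsetP.xs⊆ys++xs v u) s
      mass-++ : ∀ u v → mass (u ++ v) ≤ mass u · mass v
      mass-++ u v = begin
        weight (u ++ v) · ind (satisfiable (u ++ v))
          ≡⟨ cong (_· ind (satisfiable (u ++ v))) (weight-++ u v) ⟩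
        (weight u · weight v) · ind (satisfiable (u ++ v))
          ≤⟨ ·-monoˡ _ (·-nonneg (weight-nonneg u) (weight-nonneg v)) (ind-≤-· _ _ _ (halves u v)) ⟩
        (weight u · weight v) · (ind (satisfiable u) · ind (satisfiable v))
          ≡⟨ interchange (weight u) (weight v) _ _ ⟩
        mass u · mass v ∎

    module _ (w-total : sumℚ (map w cs) ≡ 1ℚ) where

      unsatProb-complement : ∀ m → unsatProb m ≡ 1ℚ - satProb m
      unsatProb-complement m = begin
        unsatProb m                          ≡⟨ solve 2 (λ a b → a := (a :+ b) :- b) refl (unsatProb m) (satProb m) ⟩
        (unsatProb m + satProb m) - satProb m  ≡⟨ cong (_- satProb m) unsat+sat ⟩
        1ℚ - satProb m                       ∎
        where
        open ≡-Reasoning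
        open +-*-Solver
        unsat+sat : unsatProb m + satProb m ≡ 1ℚ
        unsat+sat = begin
          unsatProb m + satProb m
            ≡⟨ sym (sum-+ _ _ (tuples m cs)) ⟩
          sumℚ (map (λ ℓ → weight ℓ · ind (not (satisfiable ℓ)) + weight ℓ · ind (satisfiable ℓ)) (tuples m cs))
            ≡⟨ sum-cong (tuples m cs) (λ ℓ → trans (sym (QP.*-distribˡ-+ (weight ℓ) _ _))
                 (trans (cong (weight ℓ ·_) (ind-not-+ (satisfiable ℓ))) (QP.*-identityʳ (weight ℓ)))) ⟩
          sumℚ (map weight (tuples m cs))
            ≡⟨ total-weight w-total m ⟩
          1ℚ ∎

      satProb-≤1 : ∀ m → satProb m ≤ 1ℚ
      satProb-≤1 m = QP.≤-trans
        (sum-mono (tuples m cs) (λ ℓ → QP.≤-trans (·-monoˡ (weight ℓ) (weight-nonneg ℓ) (ind-≤1 _))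
                                                 (QP.≤-reflexive (QP.*-identityʳ (weight ℓ)))))
        (QP.≤-reflexive (total-weight w-total m))

      satProb-power : ∀ m k r → satProb (k * m N.+ r) ≤ satProb m ^ k · satProb r
      satProb-power m N.zero    r = QP.≤-reflexive (sym (QP.*-identityˡ (satProb r)))
      satProb-power m (N.suc k) r = begin
        satProb ((m N.+ k * m) N.+ r)   ≡⟨ cong satProb (NP.+-assoc m (k * m) r) ⟩
        satProb (m N.+ (k * m N.+ r))   ≤⟨ satProb-submult m (k * m N.+ r) ⟩
        satProb m · satProb (k * m N.+ r) ≤⟨ ·-monoˡ (satProb m) (satProb-nonneg m) (satProb-power m k r) ⟩
        satProb m · (satProb m ^ k · satProb r) ≡⟨ sym (QP.*-assoc (satProb m) _ _) ⟩
        satProb m ^ N.suc k · satProb r ∎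
        where open QP.≤-Reasoning

      -- σ(m') ≤ σ(m)^k when k m ≤ m': the remaining m' - k m clauses only help.
      satProb-amplify : ∀ m k m' → k * m N.≤ m' → satProb m' ≤ satProb m ^ k
      satProb-amplify m k m' km≤m' = begin
        satProb m'                          ≡⟨ cong satProb (sym (NP.m+[n∸m]≡n km≤m')) ⟩
        satProb (k * m N.+ r)               ≤⟨ satProb-power m k r ⟩
        satProb m ^ k · satProb r           ≤⟨ ·-monoˡ _ (^-nonneg k (satProb-nonneg m)) (satProb-≤1 r) ⟩
        satProb m ^ k · 1ℚ                  ≡⟨ QP.*-identityʳ _ ⟩
        satProb m ^ k ∎
        where
        open QP.≤-Reasoning
        r = m' N.∸ k * m

      unsat-amplification : ∀ {e ε} m k m' → e ≤ unsatProb m → k * m N.≤ m' →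
        (∀ x → 0ℚ ≤ x → x ≤ 1ℚ - e → x ^ k ≤ ε) → 1ℚ - ε ≤ unsatProb m'
      unsat-amplification {e} {ε} m k m' e≤unsat km≤m' decay =
        subst (1ℚ - ε ≤_) (sym (unsatProb-complement m'))
              (QP.+-monoʳ-≤ 1ℚ (QP.neg-antimono-≤ σ[m']≤ε))
        where
        σ[m]≤1-e : satProb m ≤ 1ℚ - e
        σ[m]≤1-e = ≤-1-swap e (satProb m) (subst (e ≤_) (unsatProb-complement m) e≤unsat)
        σ[m']≤ε : satProb m' ≤ ε
        σ[m']≤ε = QP.≤-trans (satProb-amplify m k m' km≤m')
                             (decay (satProb m) (satProb-nonneg m) σ[m]≤1-e)

allFuns-tuples : {A : Set} (k : ℕ) (xs : List A) →
  map (λ F → map F (allFin k)) (allFuns k xs) ≡ tuples k xs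
allFuns-tuples N.zero    xs = refl
allFuns-tuples {A} (N.suc k) xs =
  trans (LP.map-concatMap toTuple _ xs) (LP.concatMap-cong (λ a → prepend a _ (λ f → refl) (λ f i → refl)) xs)
  where
  open ≡-Reasoning
  toTuple : (Fin (N.suc k) → A) → List A
  toTuple F = map F (allFin (N.suc k))
  prepend : ∀ a (g : (Fin k → A) → Fin (N.suc k) → A) → (∀ f → g f zero ≡ a) → (∀ f i → g f (suc i) ≡ f i) →
            map toTuple (map g (allFuns k xs)) ≡ map (a ∷_) (tuples k xs)
  prepend a g g-head g-tail = begin
    map toTuple (map g (allFuns k xs))
      ≡⟨ sym (LP.map-∘ (allFuns k xs)) ⟩
    map (λ f → toTuple (g f)) (allFuns k xs)
      ≡⟨ LP.map-cong (λ f → cong₂ _∷_ (g-head f) (tail-tuple f)) (allFuns k xs) ⟩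
    map (λ f → a ∷ map f (allFin k)) (allFuns k xs)
      ≡⟨ LP.map-∘ (allFuns k xs) ⟩
    map (a ∷_) (map (λ f → map f (allFin k)) (allFuns k xs))
      ≡⟨ cong (map (a ∷_)) (allFuns-tuples k xs) ⟩
    map (a ∷_) (tuples k xs) ∎
    where
    tail-tuple : ∀ f → map (g f) (tabulate suc) ≡ map f (allFin k)
    tail-tuple f = trans (LP.map-tabulate suc (g f))
                         (trans (LP.tabulate-cong (g-tail f)) (sym (LP.map-tabulate (λ i → i) f)))

allFuns-complete : {A A' : Set} (R : A → A' → Set) (k : ℕ) (xs : List A) (g : Fin k → A') →
  (∀ i → Any (λ x → R x (g i)) xs) → Any (λ F → ∀ i → R (F i) (g i)) (allFuns k xs)
allFuns-complete R N.zero    xs g g∈xs = here (λ ())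
allFuns-complete R (N.suc k) xs g g∈xs = AnyP.concatMap⁺ _ (Any.map extend (g∈xs zero))
  where
  extend : ∀ {a} → R a (g zero) → Any _ (map _ (allFuns k xs))
  extend Ra = AnyP.map⁺ (Any.map (λ RF → λ { zero → Ra ; (suc i) → RF i })
                                 (allFuns-complete R k xs (g ∘ suc) (g∈xs ∘ suc)))

Realised : (B h : ℕ) → List ℕ → Set
Realised B h K = Any (λ c → T (hasType K c)) (allClauses B h)

padded : {B : ℕ} → List ℕ → Fin B → ℕ
padded []       i       = 0
padded (k ∷ ks) zero    = k
padded (k ∷ ks) (suc i) = padded ks i

firstVars : {h : ℕ} → ℕ → Fin h → Maybe Bool
firstVars N.zero    a       = nothing
firstVars (N.suc k) zero    = just true
firstVars (N.suc k) (suc a) = firstVars k a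

canonical : {B h : ℕ} → List ℕ → Clause B h
canonical K i = firstVars (padded K i)

firstVars-count : ∀ h k → k N.≤ h → length (filterᵇ is-just (map (firstVars {h} k) (allFin h))) ≡ k
firstVars-count h N.zero _ = cong length (no-literals (allFin h))
  where
  no-literals : {A : Set} (xs : List A) → filterᵇ is-just (map (λ _ → nothing {A = Bool}) xs) ≡ []
  no-literals []       = refl
  no-literals (x ∷ xs) = no-literals xs
firstVars-count (N.suc h) (N.suc k) (N.s≤s k≤h) = cong N.suc (trans
  (cong (length ∘ filterᵇ is-just)
        (trans (LP.map-tabulate suc (firstVars {N.suc h} (N.suc k))) (sym (LP.map-tabulate (λ i → i) (firstVars {h} k)))))
  (firstVars-count h k k≤h))

padded-≤ : ∀ {B h} (K : List ℕ) → All (N._≤ h) K → (i : Fin B) → padded K i N.≤ h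
padded-≤ []      _           i       = N.z≤n
padded-≤ (k ∷ K) (k≤h ∷ _)   zero    = k≤h
padded-≤ (k ∷ K) (_ ∷ K≤h)   (suc i) = padded-≤ K K≤h i

nonzero : ℕ → Bool
nonzero k = not (k N.≡ᵇ 0)

padded-nonzero : ∀ B (K : List ℕ) → length K N.≤ B → All (1 N.≤_) K →
  filterᵇ nonzero (map (padded K) (allFin B)) ≡ K
padded-nonzero B [] _ _ = zeros (allFin B)
  where
  zeros : (xs : List (Fin B)) → filterᵇ nonzero (map (padded []) xs) ≡ []
  zeros []       = refl
  zeros (x ∷ xs) = zeros xs
padded-nonzero (N.suc B) (N.suc k ∷ K) (N.s≤s ℓ≤B) (N.s≤s N.z≤n ∷ K≥1) = cong (N.suc k ∷_)
  (trans (cong (filterᵇ nonzero)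
            (trans (LP.map-tabulate suc (padded {N.suc B} (N.suc k ∷ K))) (sym (LP.map-tabulate (λ i → i) (padded {B} K)))))
         (padded-nonzero B K ℓ≤B K≥1))

sortDesc-sorted : ∀ K → Linked N._≥_ K → sortDesc K ≡ K
sortDesc-sorted []           _               = refl
sortDesc-sorted (x ∷ [])     _               = refl
sortDesc-sorted (x ∷ y ∷ ys) (y≤x ∷ sorted) =
  trans (cong (insertDesc x) (sortDesc-sorted (y ∷ ys) sorted)) insert-head
  where
  insert-head : insertDesc x (y ∷ ys) ≡ x ∷ y ∷ ys
  insert-head with y N.≤ᵇ x | NP.≤⇒≤ᵇ y≤x
  ... | true | _ = refl

canonical-type : ∀ {B h} (K : List ℕ) → IsClauseType K → FitsType B h K →
  (c : Clause B h) → (∀ i a → c i a ≡ canonical K i a) → clauseType c ≡ K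
canonical-type {B} {h} K (_ , K≥1 , K-sorted) (ℓ≤B , K≤h) c c≗canonical = begin
  sortDesc (filterᵇ nonzero (map (commCount c) (allFin B)))
    ≡⟨ cong (sortDesc ∘ filterᵇ nonzero) (LP.map-cong counts (allFin B)) ⟩
  sortDesc (filterᵇ nonzero (map (padded K) (allFin B)))
    ≡⟨ cong sortDesc (padded-nonzero B K ℓ≤B K≥1) ⟩
  sortDesc K
    ≡⟨ sortDesc-sorted K K-sorted ⟩
  K ∎
  where
  open ≡-Reasoning
  counts : ∀ i → commCount c i ≡ padded K i
  counts i = trans (cong (length ∘ filterᵇ is-just) (LP.map-cong (c≗canonical i) (allFin h)))
                   (firstVars-count h (padded K i) (padded-≤ K K≤h i))

-- The canonical clause occurs in allClauses (up to pointwise equality), so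
-- every clause type that fits the communities is realised.
type-realised : ∀ {B h} (K : List ℕ) → IsClauseType K → FitsType B h K → Realised B h K
type-realised {B} {h} K isType fits =
  Any.map (λ {c} c≗canonical → fromWitness (canonical-type K isType fits c c≗canonical))
    (allFuns-complete (λ f g → ∀ a → f a ≡ g a) B (allFuns h maybeBools) (canonical K)
      (λ i → allFuns-complete _≡_ h maybeBools (canonical K i) (λ a → listed (canonical K i a))))
  where
  listed : (x : Maybe Bool) → Any (_≡ x) maybeBools
  listed nothing      = here refl
  listed (just true)  = there (here refl)
  listed (just false) = there (there (here refl))

filter-nonempty : {A : Set} (P : A → Bool) (xs : List A) → Any (T ∘ P) xs →
  ∃ λ k → length (filterᵇ P xs) ≡ N.suc k
filter-nonempty P (x ∷ xs) (here Px) with P x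
... | true  = _ , refl
... | false = ⊥-elim Px
filter-nonempty P (x ∷ xs) (there P∈xs) with P x
... | true  = _ , refl
... | false = filter-nonempty P xs P∈xs

PK-nonneg : ∀ B h K c → 0ℚ ≤ PK B h K c
PK-nonneg B h K c with hasType K c
... | true  = unif-nonneg (length (Ω B h K))
... | false = QP.≤-refl

PK-total : ∀ B h K → Realised B h K → sumℚ (map (PK B h K) (allClauses B h)) ≡ 1ℚ
PK-total B h K realised with filter-nonempty (hasType K) (allClauses B h) realised
... | k , |Ω|≡1+k = begin
  sumℚ (map (PK B h K) (allClauses B h))              ≡⟨ sum-indicator (hasType K) _ (allClauses B h) ⟩
  fromℕ (length (Ω B h K)) · unif (length (Ω B h K)) ≡⟨ cong (λ s → fromℕ s · unif s) |Ω|≡1+k ⟩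
  fromℕ (N.suc k) · unif (N.suc k)                    ≡⟨ fromℕ-unif k ⟩
  1ℚ ∎
  where open ≡-Reasoning

Pmix-nonneg : ∀ B h T K p → (∀ t → 0ℚ ≤ p t) → ∀ c → 0ℚ ≤ Pmix B h T K p c
Pmix-nonneg B h T K p p≥0 c = sum-nonneg (allFin T) (λ t → ·-nonneg (p≥0 t) (PK-nonneg B h (K t) c))

Pmix-total : ∀ B h T K p → sumℚ (map p (allFin T)) ≡ 1ℚ → (∀ t → Realised B h (K t)) →
  sumℚ (map (Pmix B h T K p) (allClauses B h)) ≡ 1ℚ
Pmix-total B h T K p p-total realised = begin
  sumℚ (map (Pmix B h T K p) cs)
    ≡⟨ sum-swap (λ c t → p t · PK B h (K t) c) cs (allFin T) ⟩
  sumℚ (map (λ t → sumℚ (map (λ c → p t · PK B h (K t) c) cs)) (allFin T))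
    ≡⟨ sum-cong (allFin T) (λ t → trans (sum-scaleˡ (p t) (PK B h (K t)) cs)
          (trans (cong (p t ·_) (PK-total B h (K t) (realised t))) (QP.*-identityʳ (p t)))) ⟩
  sumℚ (map p (allFin T))
    ≡⟨ p-total ⟩
  1ℚ ∎
  where
  open ≡-Reasoning
  cs = allClauses B h

-- F(n, m, B, P) as the product measure of P over m-tuples of clauses.
module Mixture (B h T : ℕ) (K : Fin T → List ℕ) (p : Fin T → ℚ) (p≥0 : ∀ t → 0ℚ ≤ p t) where
  open ProductMeasure (allClauses B h) (Pmix B h T K p) (Pmix-nonneg B h T K p p≥0) public
  open Satisfiability (allAssignments B h) clauseSat public

  -- PrUnsat sums over instances Fin m → Clause; tabulating them as tuples
  -- turns it into the unsatisfiable mass of the product measure.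
  PrUnsat-unsatProb : ∀ m → PrUnsat B h T K p m ≡ unsatProb m
  PrUnsat-unsatProb m = begin
    PrUnsat B h T K p m
      ≡⟨ sum-cong instances (λ F → cong₂ _·_ (cong prodℚ (LP.map-∘ (allFin m)))
           (cong (ind ∘ not ∘ or) (LP.map-cong (λ σ → cong and (LP.map-∘ (allFin m))) (allAssignments B h)))) ⟩
    sumℚ (map (unsatMass ∘ toTuple) instances)
      ≡⟨ cong sumℚ (LP.map-∘ instances) ⟩
    sumℚ (map unsatMass (map toTuple instances))
      ≡⟨ cong (sumℚ ∘ map unsatMass) (allFuns-tuples m (allClauses B h)) ⟩
    unsatProb m ∎
    where
    open ≡-Reasoning
    instances = allFuns m (allClauses B h)
    toTuple : Instance B h m → List (Clause B h)
    toTuple F = map F (allFin m)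
    unsatMass : List (Clause B h) → ℚ
    unsatMass ℓ = weight ℓ · ind (not (satisfiable ℓ))

eventually-map : ∀ {Q R : ℕ → Set} → (∀ {n} → Q n → R n) → Eventually Q → Eventually R
eventually-map Q⇒R (N , Q-from-N) = N , λ n N≤n → Q⇒R (Q-from-N n N≤n)

eventually-× : ∀ {Q R : ℕ → Set} → Eventually Q → Eventually R → Eventually (λ n → Q n × R n)
eventually-× (N₁ , Q-from-N₁) (N₂ , R-from-N₂) = N₁ N.⊔ N₂ , λ n N≤n →
  Q-from-N₁ n (NP.≤-trans (NP.m≤m⊔n N₁ N₂) N≤n) , R-from-N₂ n (NP.≤-trans (NP.m≤n⊔m N₁ N₂) N≤n)

eventually-∀ : ∀ T (Q : Fin T → ℕ → Set) → (∀ t → Eventually (Q t)) → Eventually (λ n → ∀ t → Q t n)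
eventually-∀ N.zero    Q _    = 0 , λ n _ ()
eventually-∀ (N.suc T) Q Q-ev = eventually-map (λ (Q₀ , Qₛ) → λ { zero → Q₀ ; (suc t) → Qₛ t })
  (eventually-× (Q-ev zero) (eventually-∀ T (Q ∘ suc) (Q-ev ∘ suc)))

-- m' = ω(m) gives k m(n) ≤ m'(n) eventually, for every fixed k
-- (take the ratio bound ε = 1/(k+1)).
omega-multiple : ∀ {m m' : ℕ → ℕ} → IsOmegaOf m' m → ∀ k → Eventually (λ n → k * m n N.≤ m' n)
omega-multiple {m} {m'} m'≫m k = eventually-map multiple (m'≫m (unif (N.suc k)) (unif-pos k))
  where
  multiple : ∀ {n} → fromℕ (m n) ≤ unif (N.suc k) · fromℕ (m' n) → k * m n N.≤ m' n
  multiple {n} ratio = NP.≤-trans (NP.*-monoˡ-≤ (m n) (NP.n≤1+n k)) (fromℕ-cancel-≤ (begin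
    fromℕ (N.suc k * m n)                             ≡⟨ sym (fromℕ-* (N.suc k) (m n)) ⟩
    fromℕ (N.suc k) · fromℕ (m n)                     ≤⟨ ·-monoˡ _ (fromℕ-nonneg (N.suc k)) ratio ⟩
    fromℕ (N.suc k) · (unif (N.suc k) · fromℕ (m' n)) ≡⟨ sym (QP.*-assoc (fromℕ (N.suc k)) _ _) ⟩
    (fromℕ (N.suc k) · unif (N.suc k)) · fromℕ (m' n) ≡⟨ cong (_· fromℕ (m' n)) (fromℕ-unif k) ⟩
    1ℚ · fromℕ (m' n)                                 ≡⟨ QP.*-identityˡ _ ⟩
    fromℕ (m' n)                                      ∎))
    where open QP.≤-Reasoning

lemma3p4 : (B h m m' : ℕ → ℕ) (T : ℕ) (K : Fin T → List ℕ) (p : Fin T → ℚ)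
    → Eventually (λ n → B n * h n ≡ n)
    → (∀ t → IsClauseType (K t))
    → (∀ t → Eventually (λ n → FitsType (B n) (h n) (K t)))
    → (∀ s t → K s ≡ K t → s ≡ t)
    → (∀ t → 0ℚ ≤ p t)
    → sumℚ (map p (allFin T)) ≡ 1ℚ
    → IsOmegaOf m' m
    → BoundedAwayFromZero (λ n → PrUnsat (B n) (h n) T K p (m n))
    → TendsToOne (λ n → PrUnsat (B n) (h n) T K p (m' n))
lemma3p4 B h m m' T K p _ isType fits _ p≥0 p-total m'≫m (e , e>0 , unsat-ev) ε ε>0 =
  eventually-map amplify (eventually-× (eventually-× realised-ev unsat-ev) (omega-multiple m'≫m k))
  where
  decay = geometric-decay e>0 ε>0
  k = proj₁ decay
  Pr : ℕ → ℕ → ℚ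
  Pr n = PrUnsat (B n) (h n) T K p
  realised-ev : Eventually (λ n → ∀ t → Realised (B n) (h n) (K t))
  realised-ev = eventually-∀ T (λ t n → Realised (B n) (h n) (K t))
                  (λ t → eventually-map (type-realised (K t) (isType t)) (fits t))
  amplify : ∀ {n} → ((∀ t → Realised (B n) (h n) (K t)) × e ≤ Pr n (m n)) × k * m n N.≤ m' n →
            1ℚ - ε ≤ Pr n (m' n)
  amplify {n} ((realised , e≤Pr) , km≤m') =
    subst (1ℚ - ε ≤_) (sym (PrUnsat-unsatProb (m' n)))
      (unsat-amplification (Pmix-total (B n) (h n) T K p p-total realised) (m n) k (m' n)
        (subst (e ≤_) (PrUnsat-unsatProb (m n)) e≤Pr) km≤m' (proj₂ decay))
    where open Mixture (B n) (h n) T K p p≥0
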